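{- Work in the theory $\mathsf{SB}$ described in the context, and let $\mathsf H$ be the formula defined there. Then $\mathsf{SB}$ proves that $\mathsf H$ is injective from $\mathsf A/\mathsf E_{\mathsf A}$ to $\mathsf B/\mathsf E_{\mathsf B}$: if $x\mathrel{\mathsf H}y$ and $x'\mathrel{\mathsf H}y$ then $x\,\mathsf E_{\mathsf A}\,x'$.
   Context: The theory $\mathsf{ac}$ (adjunctive class theory) is two-sorted, with a sort of objects (variables $x,y,\dots$) and a sort of classes (variables $X,Y,\dots$), identity on each sort, and a membership relation $\in$ between objects and classes, with axioms: there is a class with no members; for every class $Y$ and object $y$ there is a class $X$ with $\forall x\,(x\in X\leftrightarrow (x\in Y\vee x=y))$; classes with the same members are equal. The theory $\mathsf{SB}$ is $\mathsf{ac}$ extended with unary predicates $\mathsf A,\mathsf B$ on objects and binary predicates $\mathsf E_{\mathsf A},\mathsf E_{\mathsf B},\mathsf F,\mathsf G$ on objects, with axioms stating: $\mathsf E_{\mathsf A}$ is an equivalence relation on $\{x\mid \mathsf A x\}$; $\mathsf E_{\mathsf B}$ is an equivalence relation on $\{y\mid\mathsf B y\}$; $\mathsf F$ is an injection from $\mathsf A/\mathsf E_{\mathsf A}$ to $\mathsf B/\mathsf E_{\mathsf B}$; $\mathsf G$ is an injection from $\mathsf B/\mathsf E_{\mathsf B}$ to $\mathsf A/\mathsf E_{\mathsf A}$. Here "$\mathsf F$ is an injection from $\mathsf A/\mathsf E_{\mathsf A}$ to $\mathsf B/\mathsf E_{\mathsf B}$" means: $x\mathrel{\mathsf F}y$ implies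 $\mathsf A x$ and $\mathsf B y$; if $x\,\mathsf E_{\mathsf A}\,x'\mathrel{\mathsf F}y'\,\mathsf E_{\mathsf B}\,y$ then $x\mathrel{\mathsf F}y$; every $x\in\mathsf A$ has some $y$ with $x\mathrel{\mathsf F}y$; $x\mathrel{\mathsf F}y$ and $x\mathrel{\mathsf F}y'$ imply $y\,\mathsf E_{\mathsf B}\,y'$; $x\mathrel{\mathsf F}y$ and $x'\mathrel{\mathsf F}y$ imply $x\,\mathsf E_{\mathsf A}\,x'$. Similarly for $\mathsf G$ with the roles of $\mathsf A,\mathsf B$ swapped. A pair of classes $(X,Y)$ is downwards closed if $X\subseteq\mathsf A$, $Y\subseteq \mathsf B$, whenever $v\mathrel{\mathsf G}u$ and $u\in X$ there is $v'\in Y$ with $v'\mathrel{\mathsf G}u$, and whenever $u\mathrel{\mathsf F}v$ and $v\in Y$ there is $u'\in X$ with $u'\mathrel{\mathsf F}v$. $(X,Y)$ is an $x$-switch if it is downwards closed, $x\in X$, and every member of $X$ is in the range of $\mathsf G$. Define $x\mathrel{\mathsf H}y$ iff (there is no $x$-switch and $x\mathrel{\mathsf F}y$) or (there is an $x$-switch and $y\mathrel{\mathsf G}x$). -}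

module Defs where

open import Level using (Level; _⊔_; suc)
open import Data.Product using (Σ; Σ-syntax; ∃; ∃-syntax; _×_; _,_)
open import Data.Sum using (_⊎_)
open import Data.Empty using (⊥)
open import Relation.Nullary using (¬_)
open import Relation.Binary.PropositionalEquality using (_≡_)
open import Function.Bundles using (_⇔_)

record IsEquivOn {o r : Level} {Obj : Set o} (P : Obj → Set r) (E : Obj → Obj → Set r) : Set (o ⊔ r) where
  field
    field-l : ∀ {x y} → E x y → P x
    field-r : ∀ {x y} → E x y → P y
    refl-on : ∀ {x} → P x → E x x
    sym     : ∀ {x y} → E x y → E y x
    trans   : ∀ {x y z} → E x y → E y z → E x z

record IsInjectionQ {o r : Level} {Obj : Set o}
    (P Q : Obj → Set r) (EP EQ : Obj → Obj → Set r) (F : Obj → Obj → Set r) : Set (o ⊔ r) where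
  field
    typed      : ∀ {x y} → F x y → P x × Q y
    respects   : ∀ {x x' y' y} → EP x x' → F x' y' → EQ y' y → F x y
    total      : ∀ {x} → P x → ∃[ y ] F x y
    functional : ∀ {x y y'} → F x y → F x y' → EQ y y'
    injective  : ∀ {x x' y} → F x y → F x' y → EP x x'

record SBModel (o c r : Level) : Set (suc (o ⊔ c ⊔ r)) where
  field
    Obj   : Set o
    Class : Set c
    _∈_   : Obj → Class → Set r
    empty       : ∃[ X ] (∀ x → ¬ (x ∈ X))
    adjunction  : ∀ (Y : Class) (y : Obj) → ∃[ X ] (∀ x → (x ∈ X) ⇔ ((x ∈ Y) ⊎ (x ≡ y)))
    extensional : ∀ (X Y : Class) → (∀ x → (x ∈ X) ⇔ (x ∈ Y)) → X ≡ Y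
    A B : Obj → Set r
    EA EB F G : Obj → Obj → Set r
    EA-equiv : IsEquivOn A EA
    EB-equiv : IsEquivOn B EB
    F-inj    : IsInjectionQ A B EA EB F
    G-inj    : IsInjectionQ B A EB EA G

module _ {o c r : Level} (M : SBModel o c r) where
  open SBModel M

  _⊆A : Class → Set (o ⊔ r)
  X ⊆A = ∀ x → x ∈ X → A x

  _⊆B : Class → Set (o ⊔ r)
  Y ⊆B = ∀ y → y ∈ Y → B y

  DownwardsClosed : Class → Class → Set (o ⊔ r)
  DownwardsClosed X Y =
      X ⊆A × Y ⊆B
    × (∀ v u → G v u → u ∈ X → ∃[ v' ] (v' ∈ Y × G v' u))
    × (∀ u v → F u v → v ∈ Y → ∃[ u' ] (u' ∈ X × F u' v))

  IsSwitch : Obj → Class → Class → Set (o ⊔ r)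
  IsSwitch x X Y = DownwardsClosed X Y × x ∈ X × (∀ u → u ∈ X → ∃[ v ] G v u)

  HasSwitch : Obj → Set (o ⊔ c ⊔ r)
  HasSwitch x = ∃[ X ] ∃[ Y ] IsSwitch x X Y

  H : Obj → Obj → Set (o ⊔ c ⊔ r)
  H x y = (¬ HasSwitch x × F x y) ⊎ (HasSwitch x × G y x)

-- The mixed case is impossible: if x F y,
-- y G x' and (X, Y) is an x'-switch, then chasing y back through the switch
-- shows that x is, up to E_A, the G-image of a member of Y, so adjoining x to X
-- yields an x-switch, contradicting the choice of the F clause for x.
module Submission where

open import Level using (Level)
open import Data.Product using (∃-syntax; _×_; _,_; proj₁; proj₂)
open import Data.Sum using (inj₁; inj₂)
open import Relation.Nullary using (contradiction)
open import Relation.Binary.PropositionalEquality using (refl)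
open import Function.Bundles using (Equivalence)
open import Defs

module _ {o c r : Level} (M : SBModel o c r) where
  open SBModel M
  private
    module EA = IsEquivOn EA-equiv
    module EB = IsEquivOn EB-equiv
    module F = IsInjectionQ F-inj
    module G = IsInjectionQ G-inj

  F-respectsʳ : ∀ {u v v'} → F u v → EB v v' → F u v'
  F-respectsʳ f e = F.respects (EA.refl-on (proj₁ (F.typed f))) f e

  G-respectsʳ : ∀ {v u u'} → G v u → EA u u' → G v u'
  G-respectsʳ g e = G.respects (EB.refl-on (proj₁ (G.typed g))) g e

  switch-G-preimage : ∀ {x x' y X Y} → IsSwitch M x' X Y → F x y → G y x' →
                      ∃[ v ] (v ∈ Y × G v x)
  switch-G-preimage ((_ , _ , closedG , closedF) , x'∈X , X⊆ranG) fxy gyx' =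
    let (v , v∈Y , gvx') = closedG _ _ gyx' x'∈X
        fxv = F-respectsʳ fxy (G.injective gyx' gvx')
        (u , u∈X , fuv) = closedF _ _ fxv v∈Y
        (w , gwu) = X⊆ranG u u∈X
        (v' , v'∈Y , gv'u) = closedG w u gwu u∈X
    in v' , v'∈Y , G-respectsʳ gv'u (F.injective fuv fxv)

  adjoin-switch : ∀ {x X Y} → DownwardsClosed M X Y → (∀ u → u ∈ X → ∃[ v ] G v u) →
                  A x → ∃[ v ] (v ∈ Y × G v x) → HasSwitch M x
  adjoin-switch {x} {X} {Y} (X⊆A , Y⊆B , closedG , closedF) X⊆ranG Ax (v , v∈Y , gvx) =
    X' , Y , (X'⊆A , Y⊆B , closedG' , closedF') , x∈X' , X'⊆ranG
    where
      X' : Class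
      X' = proj₁ (adjunction X x)
      module X' u = Equivalence (proj₂ (adjunction X x) u)

      x∈X' : x ∈ X'
      x∈X' = X'.from x (inj₂ refl)

      X'⊆A : ∀ u → u ∈ X' → A u
      X'⊆A u u∈X' with X'.to u u∈X'
      ... | inj₁ u∈X = X⊆A u u∈X
      ... | inj₂ refl = Ax

      closedG' : ∀ v u → G v u → u ∈ X' → ∃[ v' ] (v' ∈ Y × G v' u)
      closedG' w u gwu u∈X' with X'.to u u∈X'
      ... | inj₁ u∈X = closedG w u gwu u∈X
      ... | inj₂ refl = v , v∈Y , gvx

      closedF' : ∀ u v → F u v → v ∈ Y → ∃[ u' ] (u' ∈ X' × F u' v)
      closedF' u w fuw w∈Y =
        let (u' , u'∈X , fu'w) = closedF u w fuw w∈Y in u' , X'.from u' (inj₁ u'∈X) , fu'w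

      X'⊆ranG : ∀ u → u ∈ X' → ∃[ v ] G v u
      X'⊆ranG u u∈X' with X'.to u u∈X'
      ... | inj₁ u∈X = X⊆ranG u u∈X
      ... | inj₂ refl = v , gvx

  switch-pullback : ∀ {x x' y} → HasSwitch M x' → F x y → G y x' → HasSwitch M x
  switch-pullback (X , Y , switch@(closed , _ , X⊆ranG)) fxy gyx' =
    adjoin-switch closed X⊆ranG (proj₁ (F.typed fxy)) (switch-G-preimage switch fxy gyx')

  H-injective : ∀ {x x' y} → H M x y → H M x' y → EA x x'
  H-injective (inj₁ (_ , fxy)) (inj₁ (_ , fx'y)) = F.injective fxy fx'y
  H-injective (inj₂ (_ , gyx)) (inj₂ (_ , gyx')) = G.functional gyx gyx'
  H-injective (inj₁ (noSwitch , fxy)) (inj₂ (switch , gyx')) =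
    contradiction (switch-pullback switch fxy gyx') noSwitch
  H-injective (inj₂ (switch , gyx)) (inj₁ (noSwitch , fx'y)) =
    contradiction (switch-pullback switch fx'y gyx) noSwitch

lemma4p2 : {o c r : Level} (M : SBModel o c r) →
    ∀ {x x' y} → H M x y → H M x' y → SBModel.EA M x x'
lemma4p2 = H-injective
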